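{- Let $T$ be a tree with at least two vertices. Then $T^{[\sharp 2]}$ consists of exactly two connected components, each of which is a clique tree.
   Context: All graphs are finite and simple. For a graph $H=(V,E)$, its exact-distance square $H^{[\sharp 2]}$ is the graph with vertex set $V$ in which distinct vertices $x,y$ are adjacent if and only if their distance in $H$ is exactly $2$. A block of a graph is a maximal subgraph without cut-vertices. A clique tree is a connected graph each of whose blocks is a complete graph. -}

module Defs where

open import Level using (0ℓ)
open import Data.Nat using (ℕ; zero; suc; _<_)
open import Data.Fin using (Fin; zero; suc; inject₁; fromℕ)
open import Data.Fin.Subset using (Subset; _∈_; _∉_; _⊆_; Nonempty; ⁅_⁆; ∁; _∩_; ⊤)
open import Data.Vec using (tabulate)
import Data.Bool
open import Data.Bool using (Bool; true; false)
open import Data.Product using (Σ; ∃; ∃-syntax; _×_; _,_)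
open import Function.Definitions using (Injective)
open import Relation.Nullary using (¬_; Dec; does)
open import Relation.Binary using (Rel; Symmetric; Irreflexive; Decidable)
open import Relation.Binary.PropositionalEquality using (_≡_)
open import Function.Bundles using (_⇔_)

record Graph (n : ℕ) : Set₁ where
  field
    Adj   : Fin n → Fin n → Set
    sym   : Symmetric Adj
    irr   : Irreflexive _≡_ Adj
    adj?  : Decidable Adj
open Graph public

data Walk {n : ℕ} (R : Fin n → Fin n → Set) : ℕ → Fin n → Fin n → Set where
  here : ∀ {x} → Walk R zero x x
  step : ∀ {k x y z} → R x y → Walk R k y z → Walk R (suc k) x z

Reach : ∀ {n} → (Fin n → Fin n → Set) → Fin n → Fin n → Set
Reach R x y = ∃[ k ] Walk R k x y

Dist : ∀ {n} → Graph n → Fin n → Fin n → ℕ → Set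
Dist G x y d = Walk (Adj G) d x y × (∀ m → m < d → ¬ Walk (Adj G) m x y)

-- Connected graph (vertex set nonempty: a graph has at least one vertex).
Connected : ∀ {n} → Graph n → Set
Connected {n} G = Nonempty (⊤ {n}) × (∀ x y → Reach (Adj G) x y)

record Cycle {n : ℕ} (G : Graph n) : Set where
  field
    m      : ℕ
    long   : 2 < suc m
    f      : Fin (suc m) → Fin n
    inj    : Injective _≡_ _≡_ f
    consec : ∀ (i : Fin m) → Adj G (f (inject₁ i)) (f (suc i))
    close  : Adj G (f (fromℕ m)) (f zero)

Acyclic : ∀ {n} → Graph n → Set
Acyclic G = ¬ Cycle G

IsTree : ∀ {n} → Graph n → Set
IsTree G = Connected G × Acyclic G

-- Exact-distance square H^[♯2]: x ~ y iff dist_H(x,y) = 2.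
-- (Distance 2 forces x ≠ y.)
ExactDistSq : ∀ {n} → Graph n → Fin n → Fin n → Set
ExactDistSq G x y = Dist G x y 2

Restrict : ∀ {n} → (Fin n → Fin n → Set) → Subset n → Fin n → Fin n → Set
Restrict R S x y = x ∈ S × y ∈ S × R x y

-- The induced subgraph R[S] is connected (any two vertices of S are
-- joined by a walk inside S).  (Nonemptiness is imposed separately.)
ConnectedOn : ∀ {n} → (Fin n → Fin n → Set) → Subset n → Set
ConnectedOn R S = ∀ x y → x ∈ S → y ∈ S → Reach (Restrict R S) x y

CutVertex : ∀ {n} → (Fin n → Fin n → Set) → Subset n → Fin n → Set
CutVertex R S v = v ∈ S × ¬ ConnectedOn R (S ∩ ∁ ⁅ v ⁆)

BlockLike : ∀ {n} → (Fin n → Fin n → Set) → Subset n → Set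
BlockLike R S = Nonempty S × ConnectedOn R S × (∀ v → ¬ CutVertex R S v)

Block : ∀ {n} → (Fin n → Fin n → Set) → Subset n → Subset n → Set
Block R U S =
  S ⊆ U × BlockLike R S ×
  (∀ S′ → S ⊆ S′ → S′ ⊆ U → BlockLike R S′ → S′ ⊆ S)

Complete : ∀ {n} → (Fin n → Fin n → Set) → Subset n → Set
Complete R S = ∀ x y → x ∈ S → y ∈ S → ¬ x ≡ y → R x y

CliqueTree : ∀ {n} → (Fin n → Fin n → Set) → Subset n → Set
CliqueTree R U =
  Nonempty U × ConnectedOn R U × (∀ S → Block R U S → Complete R S)

Class : ∀ {n} → (Fin n → Bool) → Bool → Subset n
Class c b = tabulate λ x → does (c x Data.Bool.≟ b)

-- The graph with adjacency R on Fin n has exactly two connected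
-- components, each inducing a clique tree: the vertices split into two
-- nonempty classes by c, two vertices lie in the same class iff they are
-- joined by a walk, and each class induces a clique tree.
TwoCliqueTreeComponents : ∀ {n} → (Fin n → Fin n → Set) → Set
TwoCliqueTreeComponents {n} R =
  Σ (Fin n → Bool) λ c →
    (∀ x y → (c x ≡ c y) ⇔ Reach R x y) ×
    (∀ b → Nonempty (Class c b)) ×
    (∀ b → CliqueTree R (Class c b))

-- Colour the vertices of the tree T by the parity of their depth from a root.
-- Adjacent vertices get different colours, so a walk between equally coloured
-- vertices can be cut into pairs of edges, each of which is an edge of
-- T^[♯2] or a back-and-forth step: the colour classes are the components.
-- If two equally coloured vertices x, y are at distance at least 3, the third
-- vertex w of the path from x to y has their colour and separates them in T,
-- because T is acyclic.  A walk of T^[♯2] inside a colour class avoiding w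
-- unfolds to a walk of T avoiding w, so w separates x from y in the class as
-- well, and x, y cannot lie in a common block.  Hence every block is a clique.
module Submission where

open import Defs hiding (sym)
open import Data.Nat using (ℕ; zero; suc; _+_; _≤_; _<_; z≤n; s≤s)
open import Data.Nat.Properties
  using (<-cmp; ≤-refl; ≤-antisym; ≮⇒≥; m≤n⇒m≤1+n; m<n⇒m<1+n; n<1+n; anyUpTo?)
open import Data.Nat.Induction using (<-rec)
open import Data.Fin using (Fin; zero; suc; inject₁; fromℕ; _≟_)
open import Data.Fin.Properties using (any?)
open import Data.Fin.Subset using (Subset; _∈_; ⁅_⁆; ∁; _∩_; Nonempty)
open import Data.Fin.Subset.Properties
  using (x∈p∩q⁺; x∈p∩q⁻; x∉p⇒x∈∁p; x∈∁p⇒x∉p; x≢y⇒x∉⁅y⁆; x∉⁅y⁆⇒x≢y; _∈?_)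
open import Data.Vec.Properties using (lookup∘tabulate; []=⇒lookup; lookup⇒[]=)
open import Data.Bool using (Bool; false; not) renaming (_≟_ to _≟ᵇ_)
open import Data.Bool.Properties using (not-¬; ¬-not)
open import Data.Product using (∃; _×_; _,_; proj₁; proj₂)
open import Data.Sum using (_⊎_; inj₁; inj₂)
open import Data.Empty using (⊥; ⊥-elim)
open import Function.Bundles using (mk⇔)
open import Function.Definitions using (Injective)
open import Relation.Nullary using (¬_; yes; no; does; proof)
open import Relation.Nullary.Reflects using (Reflects; invert)
open import Relation.Nullary.Decidable using (dec-true; ¬?; _×-dec_)
open import Relation.Binary using (Symmetric; Decidable; tri<; tri≈; tri>)
open import Relation.Binary.PropositionalEquality
  using (_≡_; _≢_; refl; sym; trans; cong; subst; ≢-sym)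
import Relation.Unary as U

Least : (ℕ → Set) → ℕ → Set
Least P d = P d × (∀ m → m < d → ¬ P m)

least : ∀ {P : ℕ → Set} → U.Decidable P → ∀ k → P k → ∃ (Least P)
least {P} P? = <-rec _ go
  where
  go : ∀ k → (∀ {m} → m < k → P m → ∃ (Least P)) → P k → ∃ (Least P)
  go k smaller pk with anyUpTo? P? k
  ... | yes (m , m<k , pm) = smaller m<k pm
  ... | no none            = k , pk , λ m m<k pm → none (m , m<k , pm)

module _ {n : ℕ} {R : Fin n → Fin n → Set} where

  _++ʷ_ : ∀ {k l x y z} → Walk R k x y → Walk R l y z → Walk R (k + l) x z
  here     ++ʷ w = w
  step r v ++ʷ w = step r (v ++ʷ w)

  snocʷ : ∀ {k x y z} → Walk R k x y → R y z → Walk R (suc k) x z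
  snocʷ here       r = step r here
  snocʷ (step s w) r = step s (snocʷ w r)

  reverseʷ : Symmetric R → ∀ {k x y} → Walk R k x y → Walk R k y x
  reverseʷ R-sym here       = here
  reverseʷ R-sym (step r w) = snocʷ (reverseʷ R-sym w) (R-sym r)

  walk₀⇒≡ : ∀ {x y} → Walk R 0 x y → x ≡ y
  walk₀⇒≡ here = refl

  firstEdge : ∀ {k x y} → Walk R k x y → x ≢ y → ∃ (R x)
  firstEdge here       x≢y = ⊥-elim (x≢y refl)
  firstEdge (step r _) _   = _ , r

  walk? : Decidable R → ∀ k → Decidable (Walk R k)
  walk? R? zero x y with x ≟ y
  ... | yes refl = yes here
  ... | no x≢y   = no λ w → x≢y (walk₀⇒≡ w)
  walk? R? (suc k) x y with any? (λ z → R? x z ×-dec walk? R? k z y)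
  ... | yes (_ , r , w) = yes (step r w)
  ... | no none         = no λ { (step r w) → none (_ , r , w) }

  Geodesic : Fin n → Fin n → ℕ → Set
  Geodesic x y = Least (λ k → Walk R k x y)

  geodesic : Decidable R → ∀ {k x y} → Walk R k x y → ∃ (Geodesic x y)
  geodesic R? {k} {x} {y} = least (λ m → walk? R? m x y) k

  geodesic-tail : ∀ {k x u y} → R x u → Walk R k u y → Geodesic x y (suc k) → Geodesic u y k
  geodesic-tail r w (_ , shortest) =
    w , λ m m<k w′ → shortest (suc m) (s≤s m<k) (step r w′)

  vertexAt : ∀ {k x y} → Walk R k x y → Fin (suc k) → Fin n
  vertexAt {x = x} w          zero    = x
  vertexAt         (step r w) (suc i) = vertexAt w i

  vertexAt-last : ∀ {k x y} (w : Walk R k x y) → vertexAt w (fromℕ k) ≡ y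
  vertexAt-last here       = refl
  vertexAt-last (step r w) = vertexAt-last w

  vertexAt-edge : ∀ {k x y} (w : Walk R k x y) (i : Fin k) →
                  R (vertexAt w (inject₁ i)) (vertexAt w (suc i))
  vertexAt-edge (step r w) zero    = r
  vertexAt-edge (step r w) (suc i) = vertexAt-edge w i

  walkFrom : ∀ {k x y} (w : Walk R k x y) (i : Fin (suc k)) →
             ∃ λ l → l ≤ k × Walk R l (vertexAt w i) y
  walkFrom {k} w zero    = k , ≤-refl , w
  walkFrom (step r w) (suc i) with walkFrom w i
  ... | l , l≤k , w′ = l , m≤n⇒m≤1+n l≤k , w′

  geodesic-start-unrevisited : ∀ {k x u y} (r : R x u) (w : Walk R k u y) →
    Geodesic x y (suc k) → ∀ i → x ≢ vertexAt w i
  geodesic-start-unrevisited {y = y} r w (_ , shortest) i x≡ with walkFrom w i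
  ... | l , l≤k , w′ = shortest l (s≤s l≤k) (subst (λ v → Walk R l v y) (sym x≡) w′)

  geodesic-vertexAt-injective : ∀ {k x y} (w : Walk R k x y) → Geodesic x y k →
                                Injective _≡_ _≡_ (vertexAt w)
  geodesic-vertexAt-injective w          g {zero}  {zero}  _  = refl
  geodesic-vertexAt-injective (step r w) g {zero}  {suc j} eq =
    ⊥-elim (geodesic-start-unrevisited r w g j eq)
  geodesic-vertexAt-injective (step r w) g {suc i} {zero}  eq =
    ⊥-elim (geodesic-start-unrevisited r w g i (sym eq))
  geodesic-vertexAt-injective (step r w) g {suc i} {suc j} eq =
    cong suc (geodesic-vertexAt-injective w (geodesic-tail r w g) eq)

concatMapʷ : ∀ {n} {R R′ : Fin n → Fin n → Set} → (∀ {x y} → R x y → Reach R′ x y) →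
             ∀ {k x y} → Walk R k x y → Reach R′ x y
concatMapʷ f here       = 0 , here
concatMapʷ f (step r w) = _ , proj₂ (f r) ++ʷ proj₂ (concatMapʷ f w)

Avoiding : ∀ {n} → (Fin n → Fin n → Set) → Fin n → Fin n → Fin n → Set
Avoiding R v x y = R x y × x ≢ v × y ≢ v

module _ {n : ℕ} {R : Fin n → Fin n → Set} where

  avoiding? : Decidable R → ∀ v → Decidable (Avoiding R v)
  avoiding? R? v x y = R? x y ×-dec ¬? (x ≟ v) ×-dec ¬? (y ≟ v)

  avoiding-sym : Symmetric R → ∀ {v} → Symmetric (Avoiding R v)
  avoiding-sym R-sym (r , x≢v , y≢v) = R-sym r , y≢v , x≢v

  vertexAt-avoids : ∀ {v k x y} (w : Walk (Avoiding R v) k x y) → x ≢ v →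
                    ∀ i → vertexAt w i ≢ v
  vertexAt-avoids w                      x≢v zero    = x≢v
  vertexAt-avoids (step (_ , _ , u≢v) w) _   (suc i) = vertexAt-avoids w u≢v i

  -- A visit to v would leave a walk from v to y shorter than k.
  avoidingWalk : ∀ {v k x y} → x ≢ v → (∀ m → m < k → ¬ Walk R m v y) →
                 Walk R k x y → Walk (Avoiding R v) k x y
  avoidingWalk x≢v far here       = here
  avoidingWalk {v} {suc k} x≢v far (step {y = u} r w) =
    step (r , x≢v , u≢v) (avoidingWalk u≢v (λ m m<k → far m (m<n⇒m<1+n m<k)) w)
    where
    u≢v : u ≢ v
    u≢v u≡v = far k (n<1+n k) (subst (λ z → Walk R k z _) u≡v w)

Separates : ∀ {n} → Graph n → Fin n → Fin n → Fin n → Set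
Separates G w x y = x ≢ w × y ≢ w × (∀ {k} → ¬ Walk (Avoiding (Adj G) w) k x y)

module _ {n : ℕ} (G : Graph n) where

  adj⇒≢ : ∀ {x y} → Adj G x y → x ≢ y
  adj⇒≢ e x≡y = irr G x≡y e

  separates-extend : ∀ {w u x y} → Adj G x u → x ≢ w → Separates G w u y → Separates G w x y
  separates-extend e x≢w (u≢w , y≢w , separated) =
    x≢w , y≢w , λ W → separated (step (Graph.sym G e , u≢w , x≢w) W)

  -- Otherwise a shortest such walk, closed up through v, is a cycle.
  acyclic⇒neighbours-separated : Acyclic G → ∀ {v a b} → Adj G a v → Adj G b v → a ≢ b →
                                 ∀ {k} → ¬ Walk (Avoiding (Adj G) v) k a b
  acyclic⇒neighbours-separated acyclic {v} av bv a≢b W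
    with geodesic (avoiding? (adj? G) v) W
  ... | zero  , p , _ = a≢b (walk₀⇒≡ p)
  ... | suc d , g@(p , _) = acyclic record
    { m = suc (suc d) ; long = s≤s (s≤s (s≤s z≤n)) ; f = f
    ; inj = inj ; consec = consec ; close = close }
    where
    f : Fin (suc (suc (suc d))) → Fin n
    f zero    = v
    f (suc i) = vertexAt p i

    inj : Injective _≡_ _≡_ f
    inj {zero}  {zero}  _  = refl
    inj {zero}  {suc j} eq = ⊥-elim (vertexAt-avoids p (adj⇒≢ av) j (sym eq))
    inj {suc i} {zero}  eq = ⊥-elim (vertexAt-avoids p (adj⇒≢ av) i eq)
    inj {suc i} {suc j} eq = cong suc (geodesic-vertexAt-injective p g eq)

    consec : ∀ (i : Fin (suc (suc d))) → Adj G (f (inject₁ i)) (f (suc i))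
    consec zero    = Graph.sym G av
    consec (suc i) = proj₁ (vertexAt-edge p i)

    close : Adj G (f (fromℕ (suc (suc d)))) v
    close = subst (λ u → Adj G u v) (sym (vertexAt-last p)) bv

  -- Otherwise the neighbours x and u′ of u would be joined by a walk avoiding u.
  geodesic-interior-separates : Acyclic G → ∀ {l x u u′ y}
    (e : Adj G x u) (e′ : Adj G u u′) (rest : Walk (Adj G) l u′ y) →
    Geodesic x y (suc (suc l)) → Separates G u x y
  geodesic-interior-separates acyclic {l} {x} {u} {u′} {y} e e′ rest (_ , shortest) =
    adj⇒≢ e , y≢u , λ W →
      acyclic⇒neighbours-separated acyclic e (Graph.sym G e′) x≢u′
        (W ++ʷ reverseʷ (avoiding-sym (Graph.sym G))
                 (avoidingWalk (adj⇒≢ (Graph.sym G e′)) far rest))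
    where
    y≢u : y ≢ u
    y≢u y≡u = shortest 1 (s≤s (s≤s z≤n)) (step (subst (Adj G x) (sym y≡u) e) here)
    x≢u′ : x ≢ u′
    x≢u′ x≡u′ = shortest l (m<n⇒m<1+n (n<1+n l))
                  (subst (λ z → Walk (Adj G) l z y) (sym x≡u′) rest)
    far : ∀ m → m < l → ¬ Walk (Adj G) m u y
    far m m<l w = shortest (suc m) (s≤s (m<n⇒m<1+n m<l)) (step e w)

module _ {n : ℕ} (c : Fin n → Bool) where

  ∈-Class⁻ : ∀ {x b} → x ∈ Class c b → c x ≡ b
  ∈-Class⁻ {x} {b} x∈ = invert (subst (Reflects (c x ≡ b)) lookup≡true (proof (c x ≟ᵇ b)))
    where
    lookup≡true = trans (sym (lookup∘tabulate (λ z → does (c z ≟ᵇ b)) x)) ([]=⇒lookup x∈)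

  ∈-Class⁺ : ∀ {x b} → c x ≡ b → x ∈ Class c b
  ∈-Class⁺ {x} {b} cx≡b = lookup⇒[]= x _
    (trans (lookup∘tabulate (λ z → does (c z ≟ᵇ b)) x) (dec-true (c x ≟ᵇ b) cx≡b))

  walk-inClass : ∀ {R : Fin n → Fin n → Set} → (∀ {x y} → R x y → c x ≡ c y) →
                 ∀ {k x y b} → Walk R k x y → c x ≡ b → Walk (Restrict R (Class c b)) k x y
  walk-inClass preserves here       _    = here
  walk-inClass preserves (step r w) cx≡b =
    step (∈-Class⁺ cx≡b , ∈-Class⁺ cu≡b , r) (walk-inClass preserves w cu≡b)
    where cu≡b = trans (sym (preserves r)) cx≡b

∈-∖⁺ : ∀ {n} {S : Subset n} {u w} → u ∈ S → u ≢ w → u ∈ S ∩ ∁ ⁅ w ⁆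
∈-∖⁺ u∈S u≢w = x∈p∩q⁺ (u∈S , x∉p⇒x∈∁p (x≢y⇒x∉⁅y⁆ u≢w))

∈-∖⁻ : ∀ {n} (S : Subset n) {u w} → u ∈ S ∩ ∁ ⁅ w ⁆ → u ∈ S × u ≢ w
∈-∖⁻ S {w = w} u∈ with x∈p∩q⁻ S (∁ ⁅ w ⁆) u∈
... | u∈S , u∈∁w = u∈S , x∉⁅y⁆⇒x≢y (x∈∁p⇒x∉p u∈∁w)

-- Doubly negated: being no cut-vertex only says that removing w does not
-- disconnect, which does not produce a walk constructively.
blockLike-unseparated : ∀ {n} {R : Fin n → Fin n → Set} {S : Subset n} {w x y} →
  BlockLike R S → x ∈ S → y ∈ S → x ≢ w → y ≢ w →
  ¬ ¬ Reach (Restrict R (S ∩ ∁ ⁅ w ⁆)) x y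
blockLike-unseparated {R = R} {S} {w} {x} {y} (_ , connected , noCut) x∈S y∈S x≢w y≢w unreachable
  with w ∈? S
... | yes w∈S = noCut w (w∈S , λ connected′ →
        unreachable (connected′ x y (∈-∖⁺ x∈S x≢w) (∈-∖⁺ y∈S y≢w)))
... | no  w∉S = unreachable (concatMapʷ (λ r → 1 , step (restrict r) here)
                  (proj₂ (connected x y x∈S y∈S)))
  where
  ≢w : ∀ {u} → u ∈ S → u ≢ w
  ≢w u∈S u≡w = w∉S (subst (_∈ S) u≡w u∈S)
  restrict : ∀ {u v} → Restrict R S u v → Restrict R (S ∩ ∁ ⁅ w ⁆) u v
  restrict (u∈S , v∈S , r) = ∈-∖⁺ u∈S (≢w u∈S) , ∈-∖⁺ v∈S (≢w v∈S) , r

module Bipartite {n : ℕ} (G : Graph n) (c : Fin n → Bool)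
                 (proper : ∀ {x y} → Adj G x y → c x ≢ c y) where

  twoStep-colour : ∀ {x u z} → Adj G x u → Adj G u z → c x ≡ c z
  twoStep-colour e e′ = trans (¬-not (proper e)) (sym (¬-not (proper (Graph.sym G e′))))

  exactDistSq-colour : ∀ {x y} → ExactDistSq G x y → c x ≡ c y
  exactDistSq-colour (step e (step e′ here) , _) = twoStep-colour e e′

  exactDistSq-intro : ∀ {x u z} → Adj G x u → Adj G u z → x ≢ z → ExactDistSq G x z
  exactDistSq-intro {x} {u} {z} e e′ x≢z = step e (step e′ here) , shorter
    where
    shorter : ∀ k → k < 2 → ¬ Walk (Adj G) k x z
    shorter zero          _                 w             = x≢z (walk₀⇒≡ w)
    shorter (suc zero)    _                 (step e″ here) = proper e″ (twoStep-colour e e′)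
    shorter (suc (suc k)) (s≤s (s≤s ()))

  -- Pair up the edges; a pair returning to its start is dropped.
  sameColour⇒reach : ∀ {k x y} → Walk (Adj G) k x y → c x ≡ c y → Reach (ExactDistSq G) x y
  sameColour⇒reach here                cx≡cy = 0 , here
  sameColour⇒reach (step e here)       cx≡cy = ⊥-elim (proper e cx≡cy)
  sameColour⇒reach {x = x} (step e (step {y = z} e′ w)) cx≡cy
    with sameColour⇒reach w (trans (sym (twoStep-colour e e′)) cx≡cy) | x ≟ z
  ... | reach     | yes refl = reach
  ... | k , walk  | no x≢z   = suc k , step (exactDistSq-intro e e′ x≢z) walk

  reach-colour : ∀ {k x y} → Walk (ExactDistSq G) k x y → c x ≡ c y
  reach-colour here       = refl
  reach-colour (step d w) = trans (exactDistSq-colour d) (reach-colour w)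

  exactDistSq-avoiding : ∀ {w x y} → x ≢ w → y ≢ w → c x ≡ c w →
                         ExactDistSq G x y → Walk (Avoiding (Adj G) w) 2 x y
  exactDistSq-avoiding x≢w y≢w cx≡cw (step e (step e′ here) , _) =
    step (e , x≢w , u≢w) (step (e′ , u≢w , y≢w) here)
    where u≢w = λ u≡w → proper e (trans cx≡cw (sym (cong c u≡w)))

  classes-nonempty : ∀ {u v} → Adj G u v → ∀ b → Nonempty (Class c b)
  classes-nonempty {u} {v} e b with c u ≟ᵇ b
  ... | yes cu≡b = u , ∈-Class⁺ c cu≡b
  ... | no  cu≢b =
    v , ∈-Class⁺ c (trans (¬-not (proper (Graph.sym G e))) (sym (¬-not (≢-sym cu≢b))))

  class-connected : (∀ x y → Reach (Adj G) x y) → ∀ b → ConnectedOn (ExactDistSq G) (Class c b)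
  class-connected connected b x y x∈ y∈
    with sameColour⇒reach (proj₂ (connected x y)) (trans (∈-Class⁻ c x∈) (sym (∈-Class⁻ c y∈)))
  ... | k , walk = k , walk-inClass c exactDistSq-colour walk (∈-Class⁻ c x∈)

  sameColour-exactDistSq-or-separated : Acyclic G → ∀ {k x y} → Walk (Adj G) k x y →
    c x ≡ c y → x ≢ y → ExactDistSq G x y ⊎ ∃ λ w → c w ≡ c x × Separates G w x y
  sameColour-exactDistSq-or-separated acyclic {x = x} W cx≡cy x≢y with geodesic (adj? G) W
  ... | zero , p , _               = ⊥-elim (x≢y (walk₀⇒≡ p))
  ... | suc zero , step e here , _ = ⊥-elim (proper e cx≡cy)
  ... | suc (suc zero) , g         = inj₁ g
  ... | suc (suc (suc l)) , g@(step e₁ tail@(step {y = w} e₂ (step e₃ rest)) , shortest) =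
    inj₂ (w , sym (twoStep-colour e₁ e₂) ,
          separates-extend G e₁ x≢w
            (geodesic-interior-separates G acyclic e₂ e₃ rest (geodesic-tail e₁ tail g)))
    where
    x≢w : x ≢ w
    x≢w x≡w = shortest (suc l) (m<n⇒m<1+n (n<1+n (suc l)))
                (subst (λ z → Walk (Adj G) (suc l) z _) (sym x≡w) (step e₃ rest))

  blocks-complete : Acyclic G → ∀ b S →
                    Block (ExactDistSq G) (Class c b) S → Complete (ExactDistSq G) S
  blocks-complete acyclic b S (S⊆class , blockLike@(_ , connected , _) , _) x y x∈S y∈S x≢y
    with sameColour-exactDistSq-or-separated acyclic
           (proj₂ (concatMapʷ (λ (_ , _ , d) → 2 , proj₁ d) (proj₂ (connected x y x∈S y∈S))))
           (trans (∈-Class⁻ c (S⊆class x∈S)) (sym (∈-Class⁻ c (S⊆class y∈S)))) x≢y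
  ... | inj₁ d = d
  ... | inj₂ (w , cw≡cx , x≢w , y≢w , separated) =
    ⊥-elim (blockLike-unseparated blockLike x∈S y∈S x≢w y≢w λ (_ , W) →
      separated (proj₂ (concatMapʷ lift W)))
    where
    colour≡b : ∀ {u} → u ∈ S → c u ≡ b
    colour≡b u∈S = ∈-Class⁻ c (S⊆class u∈S)

    lift : ∀ {u v} → Restrict (ExactDistSq G) (S ∩ ∁ ⁅ w ⁆) u v →
                     Reach (Avoiding (Adj G) w) u v
    lift (u∈ , v∈ , d) with ∈-∖⁻ S u∈ | ∈-∖⁻ S v∈
    ... | u∈S , u≢w | _ , v≢w =
      2 , exactDistSq-avoiding u≢w v≢w
            (trans (colour≡b u∈S) (sym (trans cw≡cx (colour≡b x∈S)))) d

odd : ℕ → Bool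
odd zero    = false
odd (suc k) = not (odd k)

odd-suc : ∀ {k l} → l ≡ suc k → odd k ≢ odd l
odd-suc l≡1+k ok≡ol = not-¬ refl (trans ok≡ol (cong odd l≡1+k))

module DepthColouring {n : ℕ} (T : Graph n) (acyclic : Acyclic T) (r : Fin n)
                      (toRoot : ∀ x → Reach (Adj T) x r) where

  depth : Fin n → ℕ
  depth x = proj₁ (geodesic (adj? T) (proj₂ (toRoot x)))

  depth-geodesic : ∀ x → Dist T x r (depth x)
  depth-geodesic x = proj₂ (geodesic (adj? T) (proj₂ (toRoot x)))

  depth-edge : ∀ {x z} → Adj T x z → depth x ≤ suc (depth z)
  depth-edge {x} {z} e =
    ≮⇒≥ λ lt → proj₂ (depth-geodesic x) (suc (depth z)) lt (step e (proj₁ (depth-geodesic z)))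

  -- Otherwise the geodesics from x and z to the root, closed up by the edge
  -- x–z, would give a cycle through x.
  adjacent-depth-≢ : ∀ {x z k} → Adj T x z → Dist T x r k → Dist T z r k → ⊥
  adjacent-depth-≢ e (here , _) (here , _) = adj⇒≢ T e refl
  adjacent-depth-≢ {x} {z} {suc k} e (step {y = x′} ex wx , shortestˣ) (step ez wz , shortestᶻ) =
    acyclic⇒neighbours-separated T acyclic (Graph.sym T ex) (Graph.sym T e) x′≢z
      (avoidingWalk (adj⇒≢ T (Graph.sym T ex)) (λ m m<k → shortestˣ m (m<n⇒m<1+n m<k)) wx
        ++ʷ reverseʷ (avoiding-sym (Graph.sym T))
              (avoidingWalk (adj⇒≢ T (Graph.sym T e)) shortestˣ (step ez wz)))
    where
    x′≢z : x′ ≢ z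
    x′≢z x′≡z = shortestᶻ k (n<1+n k) (subst (λ u → Walk (Adj T) k u r) x′≡z wx)

  colour : Fin n → Bool
  colour x = odd (depth x)

  colour-proper : ∀ {x z} → Adj T x z → colour x ≢ colour z
  colour-proper {x} {z} e with <-cmp (depth x) (depth z)
  ... | tri< lt _ _ = odd-suc (≤-antisym (depth-edge (Graph.sym T e)) lt)
  ... | tri> _ _ gt = ≢-sym (odd-suc (≤-antisym (depth-edge e) gt))
  ... | tri≈ _ eq _ =
    ⊥-elim (adjacent-depth-≢ e (depth-geodesic x) (subst (Dist T z r) (sym eq) (depth-geodesic z)))

theorem8 : ∀ {n : ℕ} (T : Graph n) → 2 ≤ n → IsTree T →
    TwoCliqueTreeComponents (ExactDistSq T)
theorem8 {suc (suc n)} T (s≤s (s≤s _)) ((_ , connected) , acyclic) =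
  colour ,
  (λ x y → mk⇔ (sameColour⇒reach (proj₂ (connected x y))) (λ (_ , w) → reach-colour w)) ,
  nonempty ,
  λ b → nonempty b , class-connected connected b , blocks-complete acyclic b
  where
  open DepthColouring T acyclic zero (λ x → connected x zero)
  open Bipartite T colour colour-proper
  nonempty : ∀ b → Nonempty (Class colour b)
  nonempty = classes-nonempty (proj₂ (firstEdge (proj₂ (connected zero (suc zero))) λ ()))
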